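{- Let $\mathcal H\subseteq 2^V$ be a Sperner hypergraph, $V=V_1\dot\cup V_2$ with $V_1,V_2\neq\emptyset$, and $S_0,S_1,S_2\subseteq V_1$ pairwise disjoint nonempty sets. Let $\mathcal H_1=\mathcal H_{V_1}\neq\emptyset$, $\mathcal H_2=\mathcal H_{V_2}$, $\mathcal F_1=\{H\in\mathcal H\mid H\cap V_1=S_0\cup S_2,\ H\cap V_2\ne\emptyset\}$, $\mathcal F_2=\{H\in\mathcal H\mid H\cap V_1=S_0\cup S_1,\ H\cap V_2\ne\emptyset\}$, with $\mathcal F_1,\mathcal F_2\neq\emptyset$ and $\mathcal H=\mathcal H_1\cup\mathcal H_2\cup\mathcal F_1\cup\mathcal F_2$. For $i=0,1,2$ let $\mathcal T_i=\{T\in\operatorname{Tr}(\mathcal H_1)\mid T\cap S_i\neq\emptyset,\ T\cap S_j=\emptyset\ (j\neq i)\}$, let $\mathcal T=\operatorname{Tr}(\mathcal H_1)\setminus(\mathcal T_0\cup\mathcal T_1\cup\mathcal T_2)$, let $\mathcal F_2'=\operatorname{Min}(\mathcal F_2^{V_2}\cup\mathcal H_2)$, and let $\mathcal P=\mathcal H_{S_0\cup S_1\cup S_2}$. Assume $\mathcal T=\emptyset$, and let $v^*\in S_0\cup S_2$ and $P\in\mathcal P$ with $v^*\notin P$. Let $\mathcal F_1^*=\{F\cup\{v^*\}\mid F\in\mathcal F_1^{V_2}\}\cup\mathcal H_2$. Then the families $\mathcal T_1\dot\wedge\operatorname{Tr}(\mathcal F_1^*)$ and $\mathcal T_2\dot\wedge\operatorname{Tr}(\mathcal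 F_2')$ are disjoint and their union is contained in $\operatorname{Tr}(\mathcal H)$.
   Context: $\operatorname{Tr}(\mathcal G)$ is the family of inclusion-minimal transversals of $\mathcal G$ (sets meeting every hyperedge), with $\operatorname{Tr}(\emptyset)=\{\emptyset\}$. A hypergraph is Sperner if no hyperedge contains another. $\mathcal H_S=\{H\in\mathcal H\mid H\subseteq S\}$; $\mathcal G^S=\operatorname{Min}\{G\cap S\mid G\in\mathcal G\}$; $\operatorname{Min}$ takes inclusion-minimal members. For families $\mathcal A,\mathcal B$, $\mathcal A\dot\wedge\mathcal B=\operatorname{Min}\{A\cup B\mid A\in\mathcal A,B\in\mathcal B\}$ (the paper uses the dot to indicate the two families live on disjoint vertex sets). -}

module Defs where

open import Data.Nat using (ℕ)
open import Data.Fin using (Fin)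
open import Data.Fin.Subset public using (Subset; _⊆_; _∩_; _∪_; ⁅_⁆; _∈_; _∉_; Nonempty; Empty; ⊥; ⊤)
open import Data.Product public using (Σ; ∃; ∃-syntax; _×_; _,_)
open import Data.Sum public using (_⊎_)
open import Data.List using (List)
open import Data.List.Membership.Propositional using () renaming (_∈_ to _∈ₗ_)
open import Relation.Binary.PropositionalEquality public using (_≡_)
open import Relation.Nullary public using (¬_)

Fam : ℕ → Set₁
Fam n = Subset n → Set

edges : ∀ {n} → List (Subset n) → Fam n
edges H E = E ∈ₗ H

Sperner : ∀ {n} → Fam n → Set
Sperner G = ∀ A B → G A → G B → A ⊆ B → A ≡ B

Min : ∀ {n} → Fam n → Fam n
Min F X = F X × (∀ Y → F Y → Y ⊆ X → Y ≡ X)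

IsTransversal : ∀ {n} → Fam n → Subset n → Set
IsTransversal G T = ∀ E → G E → Nonempty (T ∩ E)

-- Tr(G): inclusion-minimal transversals (Tr(∅) = {∅} holds automatically)
Tr : ∀ {n} → Fam n → Fam n
Tr G = Min (IsTransversal G)

restrict : ∀ {n} → Fam n → Subset n → Fam n
restrict G S E = G E × E ⊆ S

-- 𝒢^S = Min {G ∩ S | G ∈ 𝒢}
trace : ∀ {n} → Fam n → Subset n → Fam n
trace G S = Min (λ Y → ∃[ E ] (G E × Y ≡ E ∩ S))

-- 𝒜 ∧ ℬ = Min {A ∪ B | A ∈ 𝒜, B ∈ ℬ}
wedge : ∀ {n} → Fam n → Fam n → Fam n
wedge A B = Min (λ Y → ∃[ X ] ∃[ Z ] (A X × B Z × Y ≡ X ∪ Z))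

_∪ᶠ_ : ∀ {n} → Fam n → Fam n → Fam n
(A ∪ᶠ B) X = A X ⊎ B X

-- Write X = T ∪ Z with T ⊆ V₁ a minimal transversal of ℋ₁. T hits ℋ₁ and, through its vertex
-- in S₁ (resp. S₂), every edge of ℱ₂ (resp. ℱ₁); Z hits ℋ₂ and the traces on V₂ of the
-- remaining crossing family. For minimality, a transversal Y ⊆ T ∪ Z must meet the edges of
-- T's and of Z's families inside T resp. Z, so Y ⊇ T ∪ Z. The delicate case is the first
-- wedge, where Z may contain v* ∈ V₁: a minimal transversal T′ ⊆ T ∪ {v*} of ℋ₁ through v*
-- lies, as 𝒯 = ∅, outside S₁, yet must hit P ∌ v*, which only T ∩ S₁ can do. The wedges are
-- disjoint because members of the first meet S₁ and members of the second do not.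
module Submission where

open import Defs
open import Data.Nat using (ℕ)
open import Data.Fin using (Fin)
open import Data.Fin.Subset using (_⊂_)
open import Data.Fin.Subset.Properties
open import Data.Fin.Subset.Induction using (Acc; acc; ⊂-wellFounded)
open import Data.List using (List)
open import Data.List.Relation.Unary.All using (all?; tabulate; lookup)
open import Data.List.Relation.Unary.Any using (any?)
open import Data.List.Membership.Propositional using (find; lose)
open import Data.Product using (proj₁; proj₂)
open import Data.Sum using (inj₁; inj₂; [_,_]; map₁)
open import Data.Empty using (⊥-elim)
open import Relation.Nullary using (Dec; yes; no)
open import Relation.Nullary.Decidable using (map′; _×-dec_; _⊎-dec_; _→-dec_)
open import Relation.Unary using (Decidable)
open import Relation.Binary.PropositionalEquality using (refl; sym; subst)
open import Data.Vec.Properties using (≡-dec)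
open import Data.Bool.Properties using () renaming (_≟_ to _≟ᵇ_)

private
  variable
    n : ℕ

_≟ₛ_ : (A B : Subset n) → Dec (A ≡ B)
_≟ₛ_ = ≡-dec _≟ᵇ_

∈-∪-resolveˡ : ∀ {x} {A B : Subset n} → x ∈ A ∪ B → x ∉ A → x ∈ B
∈-∪-resolveˡ {A = A} {B} x∈A∪B x∉A = [ (λ x∈A → ⊥-elim (x∉A x∈A)) , (λ x∈B → x∈B) ] (x∈p∪q⁻ A B x∈A∪B)

∈-∪-resolveʳ : ∀ {x} {A B : Subset n} → x ∈ A ∪ B → x ∉ B → x ∈ A
∈-∪-resolveʳ {A = A} {B} x∈A∪B x∉B = [ (λ x∈A → x∈A) , (λ x∈B → ⊥-elim (x∉B x∈B)) ] (x∈p∪q⁻ A B x∈A∪B)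

∉-∪-of-Empty-∩ : ∀ {x} {T A B : Subset n} → Empty (T ∩ A) → Empty (T ∩ B) → x ∈ A ∪ B → x ∉ T
∉-∪-of-Empty-∩ {A = A} {B} TA TB x∈A∪B x∈T =
  [ (λ x∈A → TA (_ , x∈p∩q⁺ (x∈T , x∈A))) , (λ x∈B → TB (_ , x∈p∩q⁺ (x∈T , x∈B))) ] (x∈p∪q⁻ A B x∈A∪B)

x≡y⇒x∈⁅y⁆ : {x y : Fin n} → x ≡ y → x ∈ ⁅ y ⁆
x≡y⇒x∈⁅y⁆ refl = x∈⁅x⁆ _

Nonempty-∩-mono : {A B M E : Subset n} → A ⊆ B → M ⊆ E → Nonempty (A ∩ M) → Nonempty (B ∩ E)
Nonempty-∩-mono {A = A} {M = M} A⊆B M⊆E (x , x∈A∩M) =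
  x , x∈p∩q⁺ (A⊆B (p∩q⊆p A M x∈A∩M) , M⊆E (p∩q⊆q A M x∈A∩M))

∪-⊆ : {A B C : Subset n} → A ⊆ C → B ⊆ C → A ∪ B ⊆ C
∪-⊆ {A = A} {B} A⊆C B⊆C x∈A∪B = [ A⊆C , B⊆C ] (x∈p∪q⁻ A B x∈A∪B)

∩≡⇒⊇ : {E V S : Subset n} → E ∩ V ≡ S → S ⊆ E
∩≡⇒⊇ {E = E} {V} E∩V≡S x∈S = p∩q⊆p E V (subst (_ ∈_) (sym E∩V≡S) x∈S)

∈-∩-∩ : ∀ {x} {Y W E : Subset n} → x ∈ Y ∩ E → x ∈ W → x ∈ (Y ∩ W) ∩ E
∈-∩-∩ {Y = Y} {E = E} x∈Y∩E x∈W = x∈p∩q⁺ (x∈p∩q⁺ (p∩q⊆p Y E x∈Y∩E , x∈W) , p∩q⊆q Y E x∈Y∩E)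

Min-below : {K : Fam n} → Decidable K → ∀ X → K X → ∃[ M ] (Min K M × M ⊆ X)
Min-below {K = K} K? X = go X (⊂-wellFounded X)
  where
  go : ∀ X → Acc _⊂_ X → K X → ∃[ M ] (Min K M × M ⊆ X)
  go X (acc rec) kX with anySubset? (λ Y → K? Y ×-dec Y ⊂? X)
  ... | yes (Y , kY , Y⊂X) =
    let M , minM , M⊆Y = go Y (rec Y⊂X) kY in M , minM , ⊆-trans M⊆Y (proj₁ Y⊂X)
  ... | no ∄smaller = X , (kX , minimal) , ⊆-refl
    where
    minimal : ∀ Y → K Y → Y ⊆ X → Y ≡ X
    minimal Y kY Y⊆X = ⊆-antisym Y⊆X X⊆Y
      where
      X⊆Y : X ⊆ Y
      X⊆Y {x} x∈X with x ∈? Y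
      ... | yes x∈Y = x∈Y
      ... | no x∉Y = ⊥-elim (∄smaller (Y , kY , Y⊆X , x , x∈X , x∉Y))

Min-∪ᶠ⇒Min-Min-∪ᶠ : {A B : Fam n} {M : Subset n} → Min (A ∪ᶠ B) M → Min (Min A ∪ᶠ B) M
Min-∪ᶠ⇒Min-Min-∪ᶠ (aM⊎bM , minM) =
  map₁ (λ aM → aM , λ Y aY → minM Y (inj₁ aY)) aM⊎bM , λ Y yY → minM Y (map₁ proj₁ yY)

transversal-⊇ : {G : Fam n} {A B : Subset n} → A ⊆ B → IsTransversal G A → IsTransversal G B
transversal-⊇ A⊆B tA E gE = Nonempty-∩-mono A⊆B ⊆-refl (tA E gE)

restrict-transversal : {G : Fam n} {Y : Subset n} (V : Subset n) →
                       IsTransversal G Y → IsTransversal (restrict G V) (Y ∩ V)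
restrict-transversal {Y = Y} V tY E (gE , E⊆V) =
  let y , y∈Y∩E = tY E gE
  in y , ∈-∩-∩ y∈Y∩E (E⊆V (p∩q⊆q Y E y∈Y∩E))

Tr-⊆-of-∩ : {G : Fam n} {Z : Subset n} (Y : Subset n) → Tr G Z → IsTransversal G (Y ∩ Z) → Z ⊆ Y
Tr-⊆-of-∩ {Z = Z} Y (_ , minZ) tYZ z∈Z =
  p∩q⊆p Y Z (subst (_ ∈_) (sym (minZ (Y ∩ Z) tYZ (p∩q⊆q Y Z))) z∈Z)

Tr-⊆ : {G : Fam n} {T : Subset n} (U : Subset n) → Tr G T → (∀ E → G E → E ⊆ U) → T ⊆ U
Tr-⊆ {T = T} U trT E⊆U = Tr-⊆-of-∩ U trT tUT
  where
  tUT : IsTransversal _ (U ∩ T)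
  tUT E gE = let x , x∈T∩E = proj₁ trT E gE
                 x∈E = p∩q⊆q T E x∈T∩E
             in x , x∈p∩q⁺ (x∈p∩q⁺ (E⊆U E gE x∈E , p∩q⊆p T E x∈T∩E) , x∈E)

Tr-∪ : {G K L : Fam n} {T Z : Subset n} → IsTransversal G (T ∪ Z) → Tr K T → Tr L Z →
       (∀ Y → IsTransversal G Y → Y ⊆ T ∪ Z → IsTransversal K (Y ∩ T) × IsTransversal L (Y ∩ Z)) →
       Tr G (T ∪ Z)
Tr-∪ {T = T} {Z} tTZ trT trZ split = tTZ , minimal
  where
  minimal : ∀ Y → IsTransversal _ Y → Y ⊆ T ∪ Z → Y ≡ T ∪ Z
  minimal Y tY Y⊆TZ = ⊆-antisym Y⊆TZ λ x∈TZ →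
    [ Tr-⊆-of-∩ Y trT (proj₁ tYs) , Tr-⊆-of-∩ Y trZ (proj₂ tYs) ] (x∈p∪q⁻ T Z x∈TZ)
    where tYs = split Y tY Y⊆TZ

wedge-elim : {A B : Fam n} (P : Subset n → Set) → (∀ T Z → A T → B Z → P (T ∪ Z)) → ∀ X → wedge A B X → P X
wedge-elim P ∪-case X ((T , Z , aT , bZ , X≡T∪Z) , _) = subst P (sym X≡T∪Z) (∪-case T Z aT bZ)

module _ (L : List (Subset n)) {C : Subset n → Set} (C? : Decidable C) where

  member? : Decidable (λ E → edges L E × C E)
  member? E = any? (E ≟ₛ_) L ×-dec C? E

  transversal? : Decidable (IsTransversal (λ E → edges L E × C E))
  transversal? T = map′ (λ all E (e , c) → lookup all e c) (λ tT → tabulate λ e c → tT _ (e , c))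
                        (all? (λ E → C? E →-dec nonempty? (T ∩ E)) L)

  image? : (f : Subset n → Subset n) → Decidable (λ Y → ∃[ E ] ((edges L E × C E) × Y ≡ f E))
  image? f Y = map′ (λ any → let E , e , c , eq = find {P = Witness} any in E , (e , c) , eq)
                    (λ (E , (e , c) , eq) → lose {P = Witness} e (c , eq))
                    (any? (λ E → C? E ×-dec Y ≟ₛ f E) L)
    where
    Witness : Subset n → Set
    Witness E = C E × Y ≡ f E

  trace-below : (S : Subset n) → ∀ E → edges L E × C E → ∃[ M ] (trace (λ E → edges L E × C E) S M × M ⊆ E ∩ S)
  trace-below S E e = Min-below (image? (_∩ S)) (E ∩ S) (E , e , refl)

module Decomposition {n : ℕ} (H : List (Subset n)) (V₁ V₂ S₀ S₁ S₂ : Subset n)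
  (V₁∩V₂≡⊥ : V₁ ∩ V₂ ≡ ⊥) (V₁∪V₂≡⊤ : V₁ ∪ V₂ ≡ ⊤)
  (S₀⊆V₁ : S₀ ⊆ V₁) (S₁⊆V₁ : S₁ ⊆ V₁) (S₂⊆V₁ : S₂ ⊆ V₁) where

  ℋ ℋ₁ ℋ₂ : Fam n
  ℋ = edges H
  ℋ₁ = restrict ℋ V₁
  ℋ₂ = restrict ℋ V₂

  Crossing : Subset n → Fam n
  Crossing S E = (E ∩ V₁ ≡ S) × Nonempty (E ∩ V₂)

  crossing? : ∀ S → Decidable (Crossing S)
  crossing? S E = (E ∩ V₁) ≟ₛ S ×-dec nonempty? (E ∩ V₂)

  ℱ₁ ℱ₂ : Fam n
  ℱ₁ E = ℋ E × Crossing (S₀ ∪ S₂) E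
  ℱ₂ E = ℋ E × Crossing (S₀ ∪ S₁) E

  𝒯₀ 𝒯₁ 𝒯₂ : Fam n
  𝒯₀ T = Tr ℋ₁ T × Nonempty (T ∩ S₀) × Empty (T ∩ S₁) × Empty (T ∩ S₂)
  𝒯₁ T = Tr ℋ₁ T × Nonempty (T ∩ S₁) × Empty (T ∩ S₀) × Empty (T ∩ S₂)
  𝒯₂ T = Tr ℋ₁ T × Nonempty (T ∩ S₂) × Empty (T ∩ S₀) × Empty (T ∩ S₁)

  ℱ₂′ : Fam n
  ℱ₂′ = Min (trace ℱ₂ V₂ ∪ᶠ ℋ₂)

  ∉V₂ : ∀ {x} → x ∈ V₁ → x ∉ V₂
  ∉V₂ x∈V₁ x∈V₂ = ∉⊥ (subst (_ ∈_) V₁∩V₂≡⊥ (x∈p∩q⁺ (x∈V₁ , x∈V₂)))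

  ∈V₁⊎∈V₂ : ∀ x → x ∈ V₁ ⊎ x ∈ V₂
  ∈V₁⊎∈V₂ x = x∈p∪q⁻ V₁ V₂ (subst (x ∈_) (sym V₁∪V₂≡⊤) ∈⊤)

  Tr-ℋ₁⊆V₁ : {T : Subset n} → Tr ℋ₁ T → T ⊆ V₁
  Tr-ℋ₁⊆V₁ trT = Tr-⊆ V₁ trT λ _ → proj₂

  Tr-ℱ₂′⊆V₂ : {Z : Subset n} → Tr ℱ₂′ Z → Z ⊆ V₂
  Tr-ℱ₂′⊆V₂ trZ = Tr-⊆ V₂ trZ edge⊆V₂
    where
    edge⊆V₂ : ∀ E → ℱ₂′ E → E ⊆ V₂
    edge⊆V₂ E (inj₁ ((E′ , _ , refl) , _) , _) = p∩q⊆q E′ V₂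
    edge⊆V₂ E (inj₂ (_ , E⊆V₂) , _) = E⊆V₂

  ℱ₂′-below : ∀ W → ((λ Y → ∃[ E ] (ℱ₂ E × Y ≡ E ∩ V₂)) ∪ᶠ ℋ₂) W → ∃[ M ] (ℱ₂′ M × M ⊆ W)
  ℱ₂′-below W w =
    let M , minM , M⊆W = Min-below (λ Y → image? H (crossing? (S₀ ∪ S₁)) (_∩ V₂) Y ⊎-dec member? H (_⊆? V₂) Y) W w
    in M , Min-∪ᶠ⇒Min-Min-∪ᶠ minM , M⊆W

  ∩-avoiding⊆ : {Y T Z E : Subset n} → Y ⊆ T ∪ Z → (∀ {y} → y ∈ E → y ∉ T) → Y ∩ E ⊆ Z
  ∩-avoiding⊆ {Y} {E = E} Y⊆T∪Z E∌T y∈Y∩E = ∈-∪-resolveˡ (Y⊆T∪Z (p∩q⊆p Y E y∈Y∩E)) (E∌T (p∩q⊆q Y E y∈Y∩E))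

  ℋ₂-edge-avoids : {T E : Subset n} {y : Fin n} → T ⊆ V₁ → E ⊆ V₂ → y ∈ E → y ∉ T
  ℋ₂-edge-avoids T⊆V₁ E⊆V₂ y∈E y∈T = ∉V₂ (T⊆V₁ y∈T) (E⊆V₂ y∈E)

  crossing-edge-avoids : {T A B E : Subset n} {y : Fin n} → T ⊆ V₁ → Empty (T ∩ A) → Empty (T ∩ B) →
                         Crossing (A ∪ B) E → y ∈ E → y ∉ T
  crossing-edge-avoids T⊆V₁ T∩A T∩B (E∩V₁≡A∪B , _) y∈E y∈T =
    ∉-∪-of-Empty-∩ T∩A T∩B (subst (_ ∈_) E∩V₁≡A∪B (x∈p∩q⁺ (y∈E , T⊆V₁ y∈T))) y∈T

  ∩-transversal-ℋ₂ : {Y T Z : Subset n} → IsTransversal ℋ Y → Y ⊆ T ∪ Z → T ⊆ V₁ → IsTransversal ℋ₂ (Y ∩ Z)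
  ∩-transversal-ℋ₂ tY Y⊆T∪Z T⊆V₁ E (hE , E⊆V₂) =
    let y , y∈Y∩E = tY E hE
    in y , ∈-∩-∩ y∈Y∩E (∩-avoiding⊆ Y⊆T∪Z (ℋ₂-edge-avoids T⊆V₁ E⊆V₂) y∈Y∩E)

  module Covered (cover : ∀ E → ℋ E → ℋ₁ E ⊎ ℋ₂ E ⊎ ℱ₁ E ⊎ ℱ₂ E) where

    𝒯₂∪Tr-ℱ₂′∈Tr : ∀ T Z → 𝒯₂ T → Tr ℱ₂′ Z → Tr ℋ (T ∪ Z)
    𝒯₂∪Tr-ℱ₂′∈Tr T Z (trT , T∩S₂≠∅ , T∩S₀ , T∩S₁) trZ = Tr-∪ transversal trT trZ split
      where
      T⊆V₁ = Tr-ℋ₁⊆V₁ trT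
      Z⊆V₂ = Tr-ℱ₂′⊆V₂ trZ

      Z-meets : ∀ E W → ((λ Y → ∃[ E ] (ℱ₂ E × Y ≡ E ∩ V₂)) ∪ᶠ ℋ₂) W → W ⊆ E → Nonempty ((T ∪ Z) ∩ E)
      Z-meets E W w W⊆E = let M , ℱ₂′M , M⊆W = ℱ₂′-below W w
                          in Nonempty-∩-mono (q⊆p∪q T Z) (⊆-trans M⊆W W⊆E) (proj₁ trZ M ℱ₂′M)

      transversal : IsTransversal ℋ (T ∪ Z)
      transversal E hE with cover E hE
      ... | inj₁ ℋ₁E = Nonempty-∩-mono (p⊆p∪q Z) ⊆-refl (proj₁ trT E ℋ₁E)
      ... | inj₂ (inj₁ ℋ₂E) = Z-meets E E (inj₂ ℋ₂E) ⊆-refl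
      ... | inj₂ (inj₂ (inj₁ (_ , E∩V₁≡S₀∪S₂ , _))) =
        Nonempty-∩-mono (p⊆p∪q Z) (⊆-trans (q⊆p∪q S₀ S₂) (∩≡⇒⊇ E∩V₁≡S₀∪S₂)) T∩S₂≠∅
      ... | inj₂ (inj₂ (inj₂ ℱ₂E)) = Z-meets E (E ∩ V₂) (inj₁ (E , ℱ₂E , refl)) (p∩q⊆p E V₂)

      split : ∀ Y → IsTransversal ℋ Y → Y ⊆ T ∪ Z → IsTransversal ℋ₁ (Y ∩ T) × IsTransversal ℱ₂′ (Y ∩ Z)
      split Y tY Y⊆T∪Z = tYT , tYZ
        where
        tYT : IsTransversal ℋ₁ (Y ∩ T)
        tYT E (hE , E⊆V₁) =
          let y , y∈Y∩E = tY E hE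
              y∉Z = λ y∈Z → ∉V₂ (E⊆V₁ (p∩q⊆q Y E y∈Y∩E)) (Z⊆V₂ y∈Z)
          in y , ∈-∩-∩ y∈Y∩E (∈-∪-resolveʳ (Y⊆T∪Z (p∩q⊆p Y E y∈Y∩E)) y∉Z)
        tYZ : IsTransversal ℱ₂′ (Y ∩ Z)
        tYZ E (inj₂ ℋ₂E , _) = ∩-transversal-ℋ₂ tY Y⊆T∪Z T⊆V₁ E ℋ₂E
        tYZ E (inj₁ ((E′ , (hE′ , crossing) , refl) , _) , _) =
          let y , y∈Y∩E′ = tY E′ hE′
              y∈Z = ∩-avoiding⊆ Y⊆T∪Z (crossing-edge-avoids T⊆V₁ T∩S₀ T∩S₁ crossing) y∈Y∩E′
          in y , x∈p∩q⁺ (x∈p∩q⁺ (p∩q⊆p Y E′ y∈Y∩E′ , y∈Z) , x∈p∩q⁺ (p∩q⊆q Y E′ y∈Y∩E′ , Z⊆V₂ y∈Z))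

    module Pinned (𝒯-cover : ∀ T → Tr ℋ₁ T → 𝒯₀ T ⊎ 𝒯₁ T ⊎ 𝒯₂ T)
                  (v* : Fin n) (v*∈S₀∪S₂ : v* ∈ S₀ ∪ S₂)
                  (P : Subset n) (𝒫P : restrict ℋ (S₀ ∪ S₁ ∪ S₂) P) (v*∉P : v* ∉ P) where

      ℱ₁* : Fam n
      ℱ₁* = (λ X → ∃[ F ] (trace ℱ₁ V₂ F × X ≡ F ∪ ⁅ v* ⁆)) ∪ᶠ ℋ₂

      𝒜 ℬ : Fam n
      𝒜 = wedge 𝒯₁ (Tr ℱ₁*)
      ℬ = wedge 𝒯₂ (Tr ℱ₂′)

      Tr-ℱ₁*-∩V₁ : {Z : Subset n} {z : Fin n} → Tr ℱ₁* Z → z ∈ Z → z ∈ V₁ → z ≡ v*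
      Tr-ℱ₁*-∩V₁ trZ z∈Z z∈V₁ =
        x∈⁅y⁆⇒x≡y v* (∈-∪-resolveˡ (Tr-⊆ (V₂ ∪ ⁅ v* ⁆) trZ edge⊆ z∈Z) (∉V₂ z∈V₁))
        where
        edge⊆ : ∀ E → ℱ₁* E → E ⊆ V₂ ∪ ⁅ v* ⁆
        edge⊆ E (inj₁ (F , ((E′ , _ , refl) , _) , refl)) = ∪-⊆ (⊆-trans (p∩q⊆q E′ V₂) (p⊆p∪q ⁅ v* ⁆)) (q⊆p∪q V₂ ⁅ v* ⁆)
        edge⊆ E (inj₂ (_ , E⊆V₂)) = ⊆-trans E⊆V₂ (p⊆p∪q ⁅ v* ⁆)

      ∋v*⇒Empty-∩S₁ : {T : Subset n} → Tr ℋ₁ T → v* ∈ T → Empty (T ∩ S₁)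
      ∋v*⇒Empty-∩S₁ trT v*∈T with 𝒯-cover _ trT
      ... | inj₁ (_ , _ , T∩S₁ , _) = T∩S₁
      ... | inj₂ (inj₂ (_ , _ , _ , T∩S₁)) = T∩S₁
      ... | inj₂ (inj₁ (_ , _ , T∩S₀ , T∩S₂)) = ⊥-elim (∉-∪-of-Empty-∩ T∩S₀ T∩S₂ v*∈S₀∪S₂ v*∈T)

      Tr-ℋ₁⊆T∪v*⇒⊆T : {T T′ : Subset n} → 𝒯₁ T → Tr ℋ₁ T′ → T′ ⊆ T ∪ ⁅ v* ⁆ → T′ ⊆ T
      Tr-ℋ₁⊆T∪v*⇒⊆T {T} {T′} (_ , _ , T∩S₀ , T∩S₂) trT′ T′⊆T∪v* {t} t∈T′ with t ∈? T
      ... | yes t∈T = t∈T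
      ... | no t∉T = ⊥-elim (v*∉T′ (subst (_∈ T′) (x∈⁅y⁆⇒x≡y v* (∈-∪-resolveˡ (T′⊆T∪v* t∈T′) t∉T)) t∈T′))
        where
        P⊆V₁ : P ⊆ V₁
        P⊆V₁ = ⊆-trans (proj₂ 𝒫P) (∪-⊆ S₀⊆V₁ (∪-⊆ S₁⊆V₁ S₂⊆V₁))
        v*∉T′ : v* ∉ T′
        v*∉T′ v*∈T′ with proj₁ trT′ P (proj₁ 𝒫P , P⊆V₁)
        ... | p , p∈T′∩P with x∈p∪q⁻ T ⁅ v* ⁆ (T′⊆T∪v* (p∩q⊆p T′ P p∈T′∩P))
        ...   | inj₂ p∈v* = v*∉P (subst (_∈ P) (x∈⁅y⁆⇒x≡y v* p∈v*) (p∩q⊆q T′ P p∈T′∩P))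
        ...   | inj₁ p∈T with x∈p∪q⁻ S₀ (S₁ ∪ S₂) (proj₂ 𝒫P (p∩q⊆q T′ P p∈T′∩P))
        ...     | inj₁ p∈S₀ = T∩S₀ (p , x∈p∩q⁺ (p∈T , p∈S₀))
        ...     | inj₂ p∈S₁∪S₂ =
          let p∈S₁ = ∈-∪-resolveʳ p∈S₁∪S₂ λ p∈S₂ → T∩S₂ (p , x∈p∩q⁺ (p∈T , p∈S₂))
          in ∋v*⇒Empty-∩S₁ trT′ v*∈T′ (p , x∈p∩q⁺ (p∩q⊆p T′ P p∈T′∩P , p∈S₁))

      𝒯₁∪Tr-ℱ₁*∈Tr : ∀ T Z → 𝒯₁ T → Tr ℱ₁* Z → Tr ℋ (T ∪ Z)
      𝒯₁∪Tr-ℱ₁*∈Tr T Z 𝒯₁T@(trT , T∩S₁≠∅ , T∩S₀ , T∩S₂) trZ = Tr-∪ transversal trT trZ split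
        where
        T⊆V₁ = Tr-ℋ₁⊆V₁ trT

        transversal : IsTransversal ℋ (T ∪ Z)
        transversal E hE with cover E hE
        ... | inj₁ ℋ₁E = Nonempty-∩-mono (p⊆p∪q Z) ⊆-refl (proj₁ trT E ℋ₁E)
        ... | inj₂ (inj₁ ℋ₂E) = Nonempty-∩-mono (q⊆p∪q T Z) ⊆-refl (proj₁ trZ E (inj₂ ℋ₂E))
        ... | inj₂ (inj₂ (inj₁ ℱ₁E@(_ , E∩V₁≡S₀∪S₂ , _))) =
          let M , traceM , M⊆E∩V₂ = trace-below H (crossing? (S₀ ∪ S₂)) V₂ E ℱ₁E
              M∪v*⊆E = ∪-⊆ (⊆-trans M⊆E∩V₂ (p∩q⊆p E V₂)) (λ x∈v* →
                         ∩≡⇒⊇ E∩V₁≡S₀∪S₂ (subst (_∈ S₀ ∪ S₂) (sym (x∈⁅y⁆⇒x≡y v* x∈v*)) v*∈S₀∪S₂))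
          in Nonempty-∩-mono (q⊆p∪q T Z) M∪v*⊆E (proj₁ trZ _ (inj₁ (M , traceM , refl)))
        ... | inj₂ (inj₂ (inj₂ (_ , E∩V₁≡S₀∪S₁ , _))) =
          Nonempty-∩-mono (p⊆p∪q Z) (⊆-trans (q⊆p∪q S₀ S₁) (∩≡⇒⊇ E∩V₁≡S₀∪S₁)) T∩S₁≠∅

        split : ∀ Y → IsTransversal ℋ Y → Y ⊆ T ∪ Z → IsTransversal ℋ₁ (Y ∩ T) × IsTransversal ℱ₁* (Y ∩ Z)
        split Y tY Y⊆T∪Z = tYT , tYZ
          where
          Y∩V₁⊆T∪v* : Y ∩ V₁ ⊆ T ∪ ⁅ v* ⁆
          Y∩V₁⊆T∪v* {y} y∈Y∩V₁ with x∈p∪q⁻ T Z (Y⊆T∪Z (p∩q⊆p Y V₁ y∈Y∩V₁))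
          ... | inj₁ y∈T = p⊆p∪q ⁅ v* ⁆ y∈T
          ... | inj₂ y∈Z = q⊆p∪q T ⁅ v* ⁆ (x≡y⇒x∈⁅y⁆ (Tr-ℱ₁*-∩V₁ trZ y∈Z (p∩q⊆q Y V₁ y∈Y∩V₁)))

          tYT : IsTransversal ℋ₁ (Y ∩ T)
          tYT with Min-below (transversal? H (_⊆? V₁)) (Y ∩ V₁) (restrict-transversal V₁ tY)
          ... | T′ , trT′ , T′⊆Y∩V₁ =
            let T′⊆T = Tr-ℋ₁⊆T∪v*⇒⊆T 𝒯₁T trT′ (⊆-trans T′⊆Y∩V₁ Y∩V₁⊆T∪v*)
            in transversal-⊇ (λ t∈T′ → x∈p∩q⁺ (p∩q⊆p Y V₁ (T′⊆Y∩V₁ t∈T′) , T′⊆T t∈T′)) (proj₁ trT′)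

          tYZ : IsTransversal ℱ₁* (Y ∩ Z)
          tYZ E (inj₂ ℋ₂E) = ∩-transversal-ℋ₂ tY Y⊆T∪Z T⊆V₁ E ℋ₂E
          tYZ E (inj₁ (F , ((E′ , (hE′ , crossing) , refl) , _) , refl)) =
            let y , y∈Y∩E′ = tY E′ hE′
                y∈Z = ∩-avoiding⊆ Y⊆T∪Z (crossing-edge-avoids T⊆V₁ T∩S₀ T∩S₂ crossing) y∈Y∩E′
                y∈E′ = p∩q⊆q Y E′ y∈Y∩E′
                y∈F∪v* = [ (λ y∈V₁ → q⊆p∪q (E′ ∩ V₂) ⁅ v* ⁆ (x≡y⇒x∈⁅y⁆ (Tr-ℱ₁*-∩V₁ trZ y∈Z y∈V₁)))
                         , (λ y∈V₂ → p⊆p∪q ⁅ v* ⁆ (x∈p∩q⁺ (y∈E′ , y∈V₂))) ] (∈V₁⊎∈V₂ y)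
            in y , x∈p∩q⁺ (x∈p∩q⁺ (p∩q⊆p Y E′ y∈Y∩E′ , y∈Z) , y∈F∪v*)

      𝒜-meets-S₁ : ∀ X → 𝒜 X → Nonempty (X ∩ S₁)
      𝒜-meets-S₁ = wedge-elim (λ X → Nonempty (X ∩ S₁))
        λ T Z (_ , T∩S₁≠∅ , _) _ → Nonempty-∩-mono (p⊆p∪q Z) ⊆-refl T∩S₁≠∅

      ℬ-avoids-S₁ : ∀ X → ℬ X → Empty (X ∩ S₁)
      ℬ-avoids-S₁ = wedge-elim (λ X → Empty (X ∩ S₁)) avoids
        where
        avoids : ∀ T Z → 𝒯₂ T → Tr ℱ₂′ Z → Empty ((T ∪ Z) ∩ S₁)
        avoids T Z (_ , _ , _ , T∩S₁) trZ (x , x∈T∪Z∩S₁) with x∈p∩q⁻ (T ∪ Z) S₁ x∈T∪Z∩S₁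
        ... | x∈T∪Z , x∈S₁ = [ (λ x∈T → T∩S₁ (x , x∈p∩q⁺ (x∈T , x∈S₁)))
                             , (λ x∈Z → ∉V₂ (S₁⊆V₁ x∈S₁) (Tr-ℱ₂′⊆V₂ trZ x∈Z)) ] (x∈p∪q⁻ T Z x∈T∪Z)

lemma12 : (n : ℕ) (H : List (Subset n)) (V₁ V₂ S₀ S₁ S₂ : Subset n) →
    Sperner (edges H) →
    V₁ ∩ V₂ ≡ ⊥ → V₁ ∪ V₂ ≡ ⊤ → Nonempty V₁ → Nonempty V₂ →
    S₀ ⊆ V₁ → S₁ ⊆ V₁ → S₂ ⊆ V₁ →
    S₀ ∩ S₁ ≡ ⊥ → S₀ ∩ S₂ ≡ ⊥ → S₁ ∩ S₂ ≡ ⊥ →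
    Nonempty S₀ → Nonempty S₁ → Nonempty S₂ →
    let ℋ = edges H
        ℋ₁ = restrict ℋ V₁
        ℋ₂ = restrict ℋ V₂
        ℱ₁ = λ E → ℋ E × (E ∩ V₁ ≡ S₀ ∪ S₂) × Nonempty (E ∩ V₂)
        ℱ₂ = λ E → ℋ E × (E ∩ V₁ ≡ S₀ ∪ S₁) × Nonempty (E ∩ V₂)
        𝒯₀ = λ T → Tr ℋ₁ T × Nonempty (T ∩ S₀) × Empty (T ∩ S₁) × Empty (T ∩ S₂)
        𝒯₁ = λ T → Tr ℋ₁ T × Nonempty (T ∩ S₁) × Empty (T ∩ S₀) × Empty (T ∩ S₂)
        𝒯₂ = λ T → Tr ℋ₁ T × Nonempty (T ∩ S₂) × Empty (T ∩ S₀) × Empty (T ∩ S₁)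
        ℱ₂′ = Min (trace ℱ₂ V₂ ∪ᶠ ℋ₂)
        𝒫 = restrict ℋ (S₀ ∪ S₁ ∪ S₂)
    in (∃[ E ] ℋ₁ E) → (∃[ E ] ℱ₁ E) → (∃[ E ] ℱ₂ E) →
       (∀ E → ℋ E → ℋ₁ E ⊎ ℋ₂ E ⊎ ℱ₁ E ⊎ ℱ₂ E) →
       -- 𝒯 = Tr(ℋ₁) ∖ (𝒯₀ ∪ 𝒯₁ ∪ 𝒯₂) is empty
       (∀ T → Tr ℋ₁ T → 𝒯₀ T ⊎ 𝒯₁ T ⊎ 𝒯₂ T) →
       (v* : Fin n) → v* ∈ (S₀ ∪ S₂) →
       (P : Subset n) → 𝒫 P → v* ∉ P →
       let ℱ₁* = (λ X → ∃[ F ] (trace ℱ₁ V₂ F × X ≡ F ∪ ⁅ v* ⁆)) ∪ᶠ ℋ₂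
           𝒜 = wedge 𝒯₁ (Tr ℱ₁*)
           ℬ = wedge 𝒯₂ (Tr ℱ₂′)
       in (∀ X → 𝒜 X → ¬ ℬ X) × (∀ X → 𝒜 X ⊎ ℬ X → Tr ℋ X)
lemma12 n H V₁ V₂ S₀ S₁ S₂ _ V₁∩V₂≡⊥ V₁∪V₂≡⊤ _ _ S₀⊆V₁ S₁⊆V₁ S₂⊆V₁ _ _ _ _ _ _ _ _ _
        cover 𝒯-cover v* v*∈S₀∪S₂ P 𝒫P v*∉P =
  (λ X 𝒜X ℬX → ℬ-avoids-S₁ X ℬX (𝒜-meets-S₁ X 𝒜X)) ,
  (λ X → [ wedge-elim (Tr ℋ) 𝒯₁∪Tr-ℱ₁*∈Tr X , wedge-elim (Tr ℋ) 𝒯₂∪Tr-ℱ₂′∈Tr X ])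
  where
  open Decomposition H V₁ V₂ S₀ S₁ S₂ V₁∩V₂≡⊥ V₁∪V₂≡⊤ S₀⊆V₁ S₁⊆V₁ S₂⊆V₁
  open Covered cover
  open Pinned 𝒯-cover v* v*∈S₀∪S₂ P 𝒫P v*∉P
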